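{- Let $q$ be a prime power, $G=\mathrm{AGL}_1(q)$, $K$ its Frobenius kernel and $C=\langle c\rangle$ a Frobenius complement of $G$. Let $q-1=st$ with positive integers $s,t$ and $t>1$. Let $\{a_0,a_1,\dots,a_{s-1}\}$ be a left transversal of $\langle c^s\rangle$ in $C$ with $a_0\in\langle c^s\rangle\setminus\{1\}$. Set $X:=\big(\bigcup_{i=1}^{s-1}a_i^{G}\big)\cup(K\setminus\{1\})$ and $Y:=\bigcup_{i=0}^{s-1}a_i^{G}$. Then $\langle c^s\rangle$ is a perfect code of $\mathrm{CS}(G,X)$. Moreover, if $a_0$ is a nonsquare of $\langle c^s\rangle$, then $\langle c^s\rangle$ is a total perfect code of $\mathrm{CS}(G,Y)$.
   Context: $\mathrm{AGL}_1(q)$ is the group of affine maps $x\mapsto\alpha x+\beta$ ($\alpha\in\mathbb{F}_q^{*}$, $\beta\in\mathbb{F}_q$) of the finite field $\mathbb{F}_q$; it is a Frobenius group whose Frobenius kernel $K$ (the translations) is elementary abelian of order $q$ and whose Frobenius complements (the point stabilizers, e.g. $\{x\mapsto\alpha x\}$) are cyclic of order $q-1$. $a^G$ is the conjugacy class of $a$. A subset $X$ of $G$ is normal if $g^{ -1}Xg=X$ for all $g$; the Cayley sum graph $\mathrm{CS}(G,X)$ has vertex set $G$ with distinct $g,h$ adjacent iff $gh\in X$. A perfect code is an independent vertex set $C$ such that every vertex outside $C$ has exactly one neighbour in $C$; a total perfect code is a vertex set $C$ such that every vertex has exactly one neighbour in $C$. An element $h$ of a subgroup $H$ is a nonsquare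 of $H$ if $h\neq k^2$ for all $k\in H$. -}

module Defs where

open import Level using (0ℓ)
open import Data.Nat as ℕ using (ℕ; zero; suc)
open import Data.Fin using (Fin)
open import Data.Product using (Σ; ∃; _×_; _,_; proj₁)
open import Data.Sum using (_⊎_)
open import Data.Empty using (⊥)
open import Relation.Nullary using (¬_)
open import Relation.Nullary.Decidable using (False; toWitnessFalse; fromWitnessFalse)
open import Relation.Binary.Definitions using (DecidableEquality)
open import Relation.Binary.PropositionalEquality
open import Algebra.Core using (Op₁; Op₂)
open import Algebra.Structures using (IsCommutativeRing)
open import Function.Bundles using (_↔_)

record Field : Set₁ where
  infixl 7 _*_
  infixl 6 _+_
  field
    Carrier : Set
    _+_ _*_ : Op₂ Carrier
    -_      : Op₁ Carrier
    0# 1#   : Carrier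
    isCommutativeRing : IsCommutativeRing _≡_ _+_ _*_ -_ 0# 1#
    _≟_     : DecidableEquality Carrier
    1≢0     : 1# ≢ 0#
    inv     : (x : Carrier) → x ≢ 0# → Carrier
    *-inv   : (x : Carrier) (p : x ≢ 0#) → x * inv x p ≡ 1#
  open IsCommutativeRing isCommutativeRing public
    using (*-assoc; *-comm; *-identityʳ; zeroˡ)

-- A finite field of order q: a field whose carrier is in bijection with Fin q.
-- (Every such q is a prime power, and every prime power arises.)
FiniteFieldOfOrder : ℕ → Field → Set
FiniteFieldOfOrder q F = Fin q ↔ Field.Carrier F

module _ {V : Set} where

  CSAdj : Op₂ V → (V → Set) → V → V → Set
  CSAdj _·_ X g h = (g ≢ h) × X (g · h)

  IsPerfectCode : (V → V → Set) → (V → Set) → Set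
  IsPerfectCode Adj C =
    (∀ g h → C g → C h → ¬ Adj g h) ×
    (∀ g → ¬ C g → Σ V λ h → C h × Adj g h × (∀ h′ → C h′ → Adj g h′ → h′ ≡ h))

  IsTotalPerfectCode : (V → V → Set) → (V → Set) → Set
  IsTotalPerfectCode Adj C =
    ∀ g → Σ V λ h → C h × Adj g h × (∀ h′ → C h′ → Adj g h′ → h′ ≡ h)

module AGL (F : Field) where
  open Field F

  nz* : ∀ {x y} → x ≢ 0# → y ≢ 0# → x * y ≢ 0#
  nz* {x} {y} px py xy≡0 = px (begin
      x                   ≡⟨ sym (*-identityʳ x) ⟩
      x * 1#              ≡⟨ cong (x *_) (sym (*-inv y py)) ⟩
      x * (y * inv y py)  ≡⟨ sym (*-assoc x y (inv y py)) ⟩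
      x * y * inv y py    ≡⟨ cong (_* inv y py) xy≡0 ⟩
      0# * inv y py       ≡⟨ zeroˡ (inv y py) ⟩
      0#                  ∎)
    where open ≡-Reasoning

  inv-nz : ∀ {x} (p : x ≢ 0#) → inv x p ≢ 0#
  inv-nz {x} p q = 1≢0 (begin
      1#           ≡⟨ sym (*-inv x p) ⟩
      x * inv x p  ≡⟨ cong (x *_) q ⟩
      x * 0#       ≡⟨ *-comm x 0# ⟩
      0# * x       ≡⟨ zeroˡ x ⟩
      0#           ∎)
    where open ≡-Reasoning

  -- An element of AGL₁(F); the nonzero-ness proof is the unit type
  -- False (α ≟ 0#), so equality of elements is equality of (α, β).
  record G : Set where
    constructor aff
    field
      α  : Carrier
      β  : Carrier
      α≢0 : False (α ≟ 0#)
  open G public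

  app : G → Carrier → Carrier
  app g x = α g * x + β g

  -- group product = composition: (g · h)(x) = g (h x)
  _·_ : G → G → G
  g · h = aff (α g * α h) (α g * β h + β g)
              (fromWitnessFalse (nz* (toWitnessFalse (α≢0 g)) (toWitnessFalse (α≢0 h))))

  e : G
  e = aff 1# 0# (fromWitnessFalse 1≢0)

  _⁻¹ : G → G
  g ⁻¹ = aff a′ (- (a′ * β g)) (fromWitnessFalse (inv-nz p))
    where
      p = toWitnessFalse (α≢0 g)
      a′ = inv (α g) p

  _^_ : G → ℕ → G
  g ^ zero = e
  g ^ suc n = g · (g ^ n)

  K : G → Set
  K g = α g ≡ 1#

  Stab : Carrier → G → Set
  Stab p g = app g p ≡ p

  ⟨_⟩ : G → G → Set
  ⟨ c ⟩ g = ∃ λ k → g ≡ c ^ k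

  -- ⟨c⟩ is a Frobenius complement, i.e. a point stabilizer
  IsFrobeniusComplement : (G → Set) → Set
  IsFrobeniusComplement C = Σ Carrier λ p → ∀ g → (C g → Stab p g) × (Stab p g → C g)

  _^G : G → G → Set
  (a ^G) g = ∃ λ x → g ≡ (x ⁻¹) · (a · x)

  LeftCoset : G → (G → Set) → G → Set
  LeftCoset a H g = Σ G λ h → H h × g ≡ a · h

  IsLeftTransversal : {s : ℕ} → (Fin s → G) → (G → Set) → (G → Set) → Set
  IsLeftTransversal {s} a H C =
    (∀ i → C (a i)) ×
    (∀ g → C g → ∃ λ i → LeftCoset (a i) H g) ×
    (∀ i j g → LeftCoset (a i) H g → LeftCoset (a j) H g → i ≡ j)

  IsNonsquareOf : G → (G → Set) → Set
  IsNonsquareOf h H = ∀ k → H k → ¬ (h ≡ k · k)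

module Submission where

-- The linear part α maps the point stabiliser C = Stab p isomorphically onto F*, and for α b ≠ 1 the
-- class b^G is exactly {g : α g = α b}. So for h ∈ H, g h ∈ a_i^G reads α g · α h = α a_i, and
-- g h ∈ K reads α g · α h = 1. Since the α a_i form a transversal of αH in F* with α a₀ ∈ αH, each g
-- has exactly one pair (i, h ∈ H) solving the first equation; when i = i₀ this h is traded for the
-- unique h ∈ H solving the second, and g h ≠ 1 there unless g ∈ H. For Y, g = h would make a₀ = h².
-- Finiteness of F is used only to make H closed under inverses.

open import Defs
open import Level using (0ℓ)
open import Data.Nat as ℕ using (ℕ; zero; suc; _∸_; _<_)
import Data.Nat.Properties as ℕ
open import Data.Fin using (Fin; fromℕ<; toℕ)
import Data.Fin as Fin
open import Data.Fin.Properties using (pigeonhole)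
open import Data.Product using (Σ; ∃; _×_; _,_; proj₁; proj₂)
open import Data.Sum using (_⊎_; inj₁; inj₂; [_,_]′)
open import Data.Empty using (⊥-elim)
open import Relation.Nullary using (¬_)
open import Relation.Nullary.Decidable using (toWitnessFalse; fromWitnessFalse; toSum)
open import Data.Bool.Properties using (T-irrelevant)
open import Relation.Binary.PropositionalEquality
open import Algebra.Bundles using (CommutativeRing)
open import Function.Bundles using (Inverse; Injection)
open import Function.Properties.Inverse using (↔-sym; ↔⇒↣)

module FieldProperties (F : Field) where
  open Field F
  open ≡-Reasoning

  commutativeRing : CommutativeRing 0ℓ 0ℓ
  commutativeRing = record { isCommutativeRing = isCommutativeRing }

  open CommutativeRing commutativeRing public
    using (+-assoc; +-comm; +-identityˡ; +-identityʳ; -‿inverseˡ; -‿inverseʳ; distribˡ; distribʳ; *-identityˡ)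
  open CommutativeRing commutativeRing using (+-group; ring; semiring)
  open import Algebra.Properties.Group +-group public
    using () renaming (∙-cancelˡ to +-cancelˡ)
  open import Algebra.Properties.Ring ring using (-1*x≈-x)
  open import Algebra.Properties.Semiring.Exp semiring public
    using () renaming (_^_ to _^ᶠ_; ^-homo-* to ^ᶠ-homo-*; ^-assocʳ to ^ᶠ-assocʳ)

  *-invˡ : ∀ x (x≢0 : x ≢ 0#) → inv x x≢0 * x ≡ 1#
  *-invˡ x x≢0 = trans (*-comm (inv x x≢0) x) (*-inv x x≢0)

  *-cancelˡ : ∀ {x} y z → x ≢ 0# → x * y ≡ x * z → y ≡ z
  *-cancelˡ {x} y z x≢0 xy≡xz = begin
    y                   ≡⟨ sym (*-identityˡ y) ⟩
    1# * y              ≡⟨ cong (_* y) (sym (*-invˡ x x≢0)) ⟩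
    x⁻¹ * x * y         ≡⟨ *-assoc x⁻¹ x y ⟩
    x⁻¹ * (x * y)       ≡⟨ cong (x⁻¹ *_) xy≡xz ⟩
    x⁻¹ * (x * z)       ≡⟨ sym (*-assoc x⁻¹ x z) ⟩
    x⁻¹ * x * z         ≡⟨ cong (_* z) (*-invˡ x x≢0) ⟩
    1# * z              ≡⟨ *-identityˡ z ⟩
    z                   ∎
    where x⁻¹ = inv x x≢0

  y*z≡1⇒x*y*z≡x : ∀ {x y z} → y * z ≡ 1# → x * y * z ≡ x
  y*z≡1⇒x*y*z≡x {x} {y} {z} yz≡1 =
    trans (*-assoc x y z) (trans (cong (x *_) yz≡1) (*-identityʳ x))

  x*[y*x⁻¹]≡y : ∀ {x} y (x≢0 : x ≢ 0#) → x * (y * inv x x≢0) ≡ y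
  x*[y*x⁻¹]≡y {x} y x≢0 = begin
    x * (y * inv x x≢0)   ≡⟨ sym (*-assoc x y (inv x x≢0)) ⟩
    x * y * inv x x≢0     ≡⟨ cong (_* inv x x≢0) (*-comm x y) ⟩
    y * x * inv x x≢0     ≡⟨ y*z≡1⇒x*y*z≡x (*-inv x x≢0) ⟩
    y                     ∎

  1⁻¹≡1 : (1≢0′ : 1# ≢ 0#) → inv 1# 1≢0′ ≡ 1#
  1⁻¹≡1 1≢0′ = trans (sym (*-identityˡ (inv 1# 1≢0′))) (*-inv 1# 1≢0′)

  x*y≡1⇒y*z≡1⇒x≡z : ∀ {x y z} → x * y ≡ 1# → y * z ≡ 1# → x ≡ z
  x*y≡1⇒y*z≡1⇒x≡z {x} {y} {z} xy≡1 yz≡1 = begin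
    x            ≡⟨ sym (y*z≡1⇒x*y*z≡x yz≡1) ⟩
    x * y * z    ≡⟨ cong (_* z) xy≡1 ⟩
    1# * z       ≡⟨ *-identityˡ z ⟩
    z            ∎

  x-y+y≡x : ∀ x y → x + - y + y ≡ x
  x-y+y≡x x y = trans (+-assoc x (- y) y) (trans (cong (x +_) (-‿inverseˡ y)) (+-identityʳ x))

  x*y+z-y≡[x-1]*y+z : ∀ x y z → x * y + z + - y ≡ (x + - 1#) * y + z
  x*y+z-y≡[x-1]*y+z x y z = begin
    x * y + z + - y            ≡⟨ +-assoc (x * y) z (- y) ⟩
    x * y + (z + - y)          ≡⟨ cong (x * y +_) (+-comm z (- y)) ⟩
    x * y + (- y + z)          ≡⟨ sym (+-assoc (x * y) (- y) z) ⟩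
    x * y + - y + z            ≡⟨ cong (λ u → x * y + u + z) (sym (-1*x≈-x y)) ⟩
    x * y + - 1# * y + z       ≡⟨ cong (_+ z) (sym (distribʳ y x (- 1#))) ⟩
    (x + - 1#) * y + z         ∎

  x≢1⇒x-1≢0 : ∀ {x} → x ≢ 1# → x + - 1# ≢ 0#
  x≢1⇒x-1≢0 {x} x≢1 x-1≡0 =
    x≢1 (trans (sym (x-y+y≡x x 1#)) (trans (cong (_+ 1#) x-1≡0) (+-identityˡ 1#)))

  1^ᶠn≡1 : ∀ n → 1# ^ᶠ n ≡ 1#
  1^ᶠn≡1 zero    = refl
  1^ᶠn≡1 (suc n) = trans (*-identityˡ (1# ^ᶠ n)) (1^ᶠn≡1 n)

  ^ᶠ-nonzero : ∀ {x} → x ≢ 0# → ∀ n → x ^ᶠ n ≢ 0#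
  ^ᶠ-nonzero x≢0 zero    = 1≢0
  ^ᶠ-nonzero x≢0 (suc n) = AGL.nz* F x≢0 (^ᶠ-nonzero x≢0 n)

module FiniteFieldProperties (F : Field) {q : ℕ} (finite : FiniteFieldOfOrder q F) where
  open Field F
  open FieldProperties F
  open ≡-Reasoning

  private
    from-injective : ∀ {x y} → Inverse.from finite x ≡ Inverse.from finite y → x ≡ y
    from-injective = Injection.injective (↔⇒↣ (↔-sym finite))

  -- Two of the q + 1 powers x⁰, …, x^q coincide.
  ^ᶠ-periodic : ∀ {x} → x ≢ 0# → ∃ λ m → x ^ᶠ suc m ≡ 1#
  ^ᶠ-periodic {x} x≢0
    with i , j , i<j , same ← pigeonhole (ℕ.n<1+n q) (λ k → Inverse.from finite (x ^ᶠ toℕ k))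
    with o , 1+i+o≡j ← ℕ.m≤n⇒∃[o]m+o≡n i<j
    = o , *-cancelˡ (x ^ᶠ suc o) 1# (^ᶠ-nonzero x≢0 (toℕ i)) (begin
      x ^ᶠ toℕ i * x ^ᶠ suc o   ≡⟨ sym (^ᶠ-homo-* x (toℕ i) (suc o)) ⟩
      x ^ᶠ (toℕ i ℕ.+ suc o)    ≡⟨ cong (x ^ᶠ_) (trans (ℕ.+-suc (toℕ i) o) 1+i+o≡j) ⟩
      x ^ᶠ toℕ j                ≡⟨ sym (from-injective same) ⟩
      x ^ᶠ toℕ i                ≡⟨ sym (*-identityʳ (x ^ᶠ toℕ i)) ⟩
      x ^ᶠ toℕ i * 1#           ∎)

  ^ᶠ-inverse : ∀ {x} → x ≢ 0# → ∀ k → ∃ λ j → x ^ᶠ k * x ^ᶠ j ≡ 1#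
  ^ᶠ-inverse {x} x≢0 k with m , xᵐ⁺¹≡1 ← ^ᶠ-periodic x≢0 = m ℕ.* k , (begin
    x ^ᶠ k * x ^ᶠ (m ℕ.* k)   ≡⟨ sym (^ᶠ-homo-* x k (m ℕ.* k)) ⟩
    x ^ᶠ (suc m ℕ.* k)        ≡⟨ sym (^ᶠ-assocʳ x (suc m) k) ⟩
    (x ^ᶠ suc m) ^ᶠ k         ≡⟨ cong (_^ᶠ k) xᵐ⁺¹≡1 ⟩
    1# ^ᶠ k                   ≡⟨ 1^ᶠn≡1 k ⟩
    1#                        ∎)

module AGLProperties (F : Field) where
  open Field F
  open FieldProperties F
  open AGL F
  open ≡-Reasoning

  α-nonzero : ∀ g → α g ≢ 0#
  α-nonzero g = toWitnessFalse (α≢0 g)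

  G-ext : ∀ {g h} → α g ≡ α h → β g ≡ β h → g ≡ h
  G-ext {aff _ _ _} {aff _ _ _} refl refl = cong (aff _ _) (T-irrelevant _ _)

  app-· : ∀ g h x → app (g · h) x ≡ app g (app h x)
  app-· g h x = begin
    α g * α h * x + (α g * β h + β g)     ≡⟨ cong (_+ (α g * β h + β g)) (*-assoc (α g) (α h) x) ⟩
    α g * (α h * x) + (α g * β h + β g)   ≡⟨ sym (+-assoc (α g * (α h * x)) (α g * β h) (β g)) ⟩
    α g * (α h * x) + α g * β h + β g     ≡⟨ cong (_+ β g) (sym (distribˡ (α g) (α h * x) (β h))) ⟩
    α g * (α h * x + β h) + β g           ∎

  Stab-e : ∀ {p} → Stab p e
  Stab-e {p} = trans (+-identityʳ (1# * p)) (*-identityˡ p)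

  Stab-· : ∀ {p g h} → Stab p g → Stab p h → Stab p (g · h)
  Stab-· {p} {g} {h} gp≡p hp≡p = trans (app-· g h p) (trans (cong (app g) hp≡p) gp≡p)

  Stab-cancelʳ : ∀ {p g h} → Stab p h → Stab p (g · h) → Stab p g
  Stab-cancelʳ {p} {g} {h} hp≡p ghp≡p = trans (cong (app g) (sym hp≡p)) (trans (sym (app-· g h p)) ghp≡p)

  Stab-^ : ∀ {p g} → Stab p g → ∀ k → Stab p (g ^ k)
  Stab-^ gp≡p zero    = Stab-e
  Stab-^ {g = g} gp≡p (suc k) = Stab-· {g = g} {h = g ^ k} gp≡p (Stab-^ gp≡p k)

  α-^ : ∀ g k → α (g ^ k) ≡ α g ^ᶠ k
  α-^ g zero    = refl
  α-^ g (suc k) = cong (α g *_) (α-^ g k)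

  -- g fixes p iff β g = p - α g p.
  Stab-α-injective : ∀ {p g h} → Stab p g → Stab p h → α g ≡ α h → g ≡ h
  Stab-α-injective {p} {g} {h} gp≡p hp≡p αg≡αh = G-ext αg≡αh (+-cancelˡ (α g * p) (β g) (β h) (begin
    α g * p + β g   ≡⟨ gp≡p ⟩
    p               ≡⟨ sym hp≡p ⟩
    α h * p + β h   ≡⟨ cong (λ u → u * p + β h) (sym αg≡αh) ⟩
    α g * p + β h   ∎))

  homothety : Carrier → G → G
  homothety p g = aff (α g) (p + - (α g * p)) (α≢0 g)

  Stab-homothety : ∀ p g → Stab p (homothety p g)
  Stab-homothety p g = begin
    α g * p + (p + - (α g * p))   ≡⟨ cong (α g * p +_) (+-comm p (- (α g * p))) ⟩
    α g * p + (- (α g * p) + p)   ≡⟨ sym (+-assoc (α g * p) (- (α g * p)) p) ⟩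
    α g * p + - (α g * p) + p     ≡⟨ cong (_+ p) (-‿inverseʳ (α g * p)) ⟩
    0# + p                        ≡⟨ +-identityˡ p ⟩
    p                             ∎

  translation : Carrier → G
  translation ν = aff 1# ν (fromWitnessFalse 1≢0)

  α-conj-translation : ∀ b ν → α ((translation ν ⁻¹) · (b · translation ν)) ≡ α b
  α-conj-translation b ν = begin
    inv 1# _ * (α b * 1#)   ≡⟨ cong (_* (α b * 1#)) (1⁻¹≡1 _) ⟩
    1# * (α b * 1#)         ≡⟨ *-identityˡ (α b * 1#) ⟩
    α b * 1#                ≡⟨ *-identityʳ (α b) ⟩
    α b                     ∎

  β-conj-translation : ∀ b ν → β ((translation ν ⁻¹) · (b · translation ν)) ≡ (α b + - 1#) * ν + β b
  β-conj-translation b ν = begin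
    inv 1# _ * (α b * ν + β b) + - (inv 1# _ * ν)   ≡⟨ cong (λ u → u * (α b * ν + β b) + - (u * ν)) (1⁻¹≡1 _) ⟩
    1# * (α b * ν + β b) + - (1# * ν)               ≡⟨ cong₂ (λ u v → u + - v) (*-identityˡ _) (*-identityˡ ν) ⟩
    α b * ν + β b + - ν                             ≡⟨ x*y+z-y≡[x-1]*y+z (α b) ν (β b) ⟩
    (α b + - 1#) * ν + β b                          ∎

  ^G⇒α≡ : ∀ b {g} → (b ^G) g → α g ≡ α b
  ^G⇒α≡ b (x , refl) = begin
    x⁻¹ * (α b * α x)    ≡⟨ cong (x⁻¹ *_) (*-comm (α b) (α x)) ⟩
    x⁻¹ * (α x * α b)    ≡⟨ sym (*-assoc x⁻¹ (α x) (α b)) ⟩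
    x⁻¹ * α x * α b      ≡⟨ cong (_* α b) (*-invˡ (α x) (α-nonzero x)) ⟩
    1# * α b             ≡⟨ *-identityˡ (α b) ⟩
    α b                  ∎
    where x⁻¹ = inv (α x) (α-nonzero x)

  -- Conjugating by the translation by ν adds (α b - 1) ν to β b, and α b ≠ 1 lets ν reach any value.
  α≡⇒^G : ∀ b {g} → α b ≢ 1# → α g ≡ α b → (b ^G) g
  α≡⇒^G b {g} αb≢1 αg≡αb = translation ν , G-ext
      (trans αg≡αb (sym (α-conj-translation b ν)))
      (sym (begin
        β ((translation ν ⁻¹) · (b · translation ν))   ≡⟨ β-conj-translation b ν ⟩
        μ * ν + β b                                    ≡⟨ cong (_+ β b) (x*[y*x⁻¹]≡y (β g + - β b) μ≢0) ⟩
        β g + - β b + β b                              ≡⟨ x-y+y≡x (β g) (β b) ⟩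
        β g                                            ∎))
    where
      μ = α b + - 1#
      μ≢0 = x≢1⇒x-1≢0 αb≢1
      ν = (β g + - β b) * inv μ μ≢0

module CyclicSubgroupOfStabiliser (F : Field) {q : ℕ} (finite : FiniteFieldOfOrder q F) where
  open Field F
  open FieldProperties F
  open FiniteFieldProperties F finite
  open AGL F
  open AGLProperties F
  open ≡-Reasoning

  module _ {p d} (d∈Stab : Stab p d) where

    ⟨⟩⊆Stab : ∀ {h} → ⟨ d ⟩ h → Stab p h
    ⟨⟩⊆Stab (k , refl) = Stab-^ d∈Stab k

    ⟨⟩-α-injective : ∀ {g h} → ⟨ d ⟩ g → ⟨ d ⟩ h → α g ≡ α h → g ≡ h
    ⟨⟩-α-injective g∈⟨d⟩ h∈⟨d⟩ = Stab-α-injective (⟨⟩⊆Stab g∈⟨d⟩) (⟨⟩⊆Stab h∈⟨d⟩)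

    ⟨⟩-· : ∀ {g h} → ⟨ d ⟩ g → ⟨ d ⟩ h → ⟨ d ⟩ (g · h)
    ⟨⟩-· (k , refl) (l , refl) = k ℕ.+ l ,
      Stab-α-injective (Stab-· {g = d ^ k} {h = d ^ l} (Stab-^ d∈Stab k) (Stab-^ d∈Stab l))
                       (Stab-^ d∈Stab (k ℕ.+ l))
                       (begin
                         α (d ^ k) * α (d ^ l)   ≡⟨ cong₂ _*_ (α-^ d k) (α-^ d l) ⟩
                         α d ^ᶠ k * α d ^ᶠ l     ≡⟨ sym (^ᶠ-homo-* (α d) k l) ⟩
                         α d ^ᶠ (k ℕ.+ l)        ≡⟨ sym (α-^ d (k ℕ.+ l)) ⟩
                         α (d ^ (k ℕ.+ l))       ∎)

    ⟨⟩-inverse : ∀ {g} → ⟨ d ⟩ g → Σ G λ h → ⟨ d ⟩ h × g · h ≡ e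
    ⟨⟩-inverse (k , refl) with j , dᵏdʲ≡1 ← ^ᶠ-inverse (α-nonzero d) k =
      d ^ j , (j , refl) ,
      Stab-α-injective (Stab-· {g = d ^ k} {h = d ^ j} (Stab-^ d∈Stab k) (Stab-^ d∈Stab j)) Stab-e
                       (trans (cong₂ _*_ (α-^ d k) (α-^ d j)) dᵏdʲ≡1)

module TransversalCodes (F : Field) {q : ℕ} (finite : FiniteFieldOfOrder q F) where
  open Field F
  open FieldProperties F
  open AGL F
  open AGLProperties F
  open CyclicSubgroupOfStabiliser F finite
  open ≡-Reasoning

  module Transversal (c : G) (p : Carrier) (⟨c⟩⇔Stab : ∀ g → (⟨ c ⟩ g → Stab p g) × (Stab p g → ⟨ c ⟩ g))
           (s : ℕ) (a : Fin s → G) (i₀ : Fin s) (transversal : IsLeftTransversal a ⟨ c ^ s ⟩ ⟨ c ⟩)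
           (a₀∈H : ⟨ c ^ s ⟩ (a i₀)) (a₀≢e : a i₀ ≢ e) where

    H : G → Set
    H = ⟨ c ^ s ⟩

    private
      cˢ∈Stab : Stab p (c ^ s)
      cˢ∈Stab = proj₁ (⟨c⟩⇔Stab (c ^ s)) (s , refl)

    H⊆Stab : ∀ {h} → H h → Stab p h
    H⊆Stab = ⟨⟩⊆Stab cˢ∈Stab

    H-α-injective : ∀ {g h} → H g → H h → α g ≡ α h → g ≡ h
    H-α-injective = ⟨⟩-α-injective cˢ∈Stab

    H-· : ∀ {g h} → H g → H h → H (g · h)
    H-· = ⟨⟩-· cˢ∈Stab

    H-inverse : ∀ {g} → H g → Σ G λ h → H h × g · h ≡ e
    H-inverse = ⟨⟩-inverse cˢ∈Stab

    a∈Stab : ∀ i → Stab p (a i)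
    a∈Stab i = proj₁ (⟨c⟩⇔Stab (a i)) (proj₁ transversal i)

    cosets-cover : ∀ g → ⟨ c ⟩ g → ∃ λ i → LeftCoset (a i) H g
    cosets-cover = proj₁ (proj₂ transversal)

    cosets-disjoint : ∀ i j g → LeftCoset (a i) H g → LeftCoset (a j) H g → i ≡ j
    cosets-disjoint = proj₂ (proj₂ transversal)

    a∈H⇒i≡i₀ : ∀ {i} → H (a i) → i ≡ i₀
    a∈H⇒i≡i₀ {i} aᵢ∈H with a₀⁻¹ , a₀⁻¹∈H , a₀a₀⁻¹≡e ← H-inverse a₀∈H =
      cosets-disjoint i i₀ (a i) aᵢ∈aᵢH aᵢ∈a₀H
      where
        aᵢ∈aᵢH : LeftCoset (a i) H (a i)
        aᵢ∈aᵢH = e , (0 , refl) ,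
          Stab-α-injective (a∈Stab i) (Stab-· {g = a i} {h = e} (a∈Stab i) Stab-e) (sym (*-identityʳ (α (a i))))

        aᵢ∈a₀H : LeftCoset (a i₀) H (a i)
        aᵢ∈a₀H = a₀⁻¹ · a i , H-· a₀⁻¹∈H aᵢ∈H ,
          Stab-α-injective (a∈Stab i)
            (Stab-· {g = a i₀} {h = a₀⁻¹ · a i} (a∈Stab i₀) (Stab-· {g = a₀⁻¹} {h = a i} (H⊆Stab a₀⁻¹∈H) (a∈Stab i)))
            (sym (begin
              α (a i₀) * (α a₀⁻¹ * α (a i))   ≡⟨ sym (*-assoc (α (a i₀)) (α a₀⁻¹) (α (a i))) ⟩
              α (a i₀) * α a₀⁻¹ * α (a i)     ≡⟨ cong (λ u → α u * α (a i)) a₀a₀⁻¹≡e ⟩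
              1# * α (a i)                    ≡⟨ *-identityˡ (α (a i)) ⟩
              α (a i)                         ∎))

    H-α⇒i≡i₀ : ∀ {i k} → H k → α k ≡ α (a i) → i ≡ i₀
    H-α⇒i≡i₀ {i} k∈H αk≡αaᵢ = a∈H⇒i≡i₀ (subst H (Stab-α-injective (H⊆Stab k∈H) (a∈Stab i) αk≡αaᵢ) k∈H)

    α-a≢1 : ∀ i → α (a i) ≢ 1#
    α-a≢1 i αaᵢ≡1 = a₀≢e (Stab-α-injective (a∈Stab i₀) Stab-e
      (subst (λ j → α (a j) ≡ 1#) (H-α⇒i≡i₀ (0 , refl) (sym αaᵢ≡1)) αaᵢ≡1))

    decompose : ∀ g → ∃ λ i → Σ G λ h → H h × α (g · h) ≡ α (a i)
    decompose g
      with i , h , h∈H , ĝ≡aᵢh ← cosets-cover (homothety p g)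
                                   (proj₂ (⟨c⟩⇔Stab (homothety p g)) (Stab-homothety p g))
      with h⁻¹ , h⁻¹∈H , hh⁻¹≡e ← H-inverse h∈H
      = i , h⁻¹ , h⁻¹∈H , (begin
        α g * α h⁻¹              ≡⟨ cong (λ u → α u * α h⁻¹) ĝ≡aᵢh ⟩
        α (a i) * α h * α h⁻¹    ≡⟨ y*z≡1⇒x*y*z≡x (cong α hh⁻¹≡e) ⟩
        α (a i)                  ∎)

    homothety∈coset : ∀ g {h i} → H h → α (g · h) ≡ α (a i) → LeftCoset (a i) H (homothety p g)
    homothety∈coset g {h} {i} h∈H gh≡aᵢ with h⁻¹ , h⁻¹∈H , hh⁻¹≡e ← H-inverse h∈H =
      h⁻¹ , h⁻¹∈H ,
      Stab-α-injective (Stab-homothety p g) (Stab-· {g = a i} {h = h⁻¹} (a∈Stab i) (H⊆Stab h⁻¹∈H)) (begin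
        α g                  ≡⟨ sym (y*z≡1⇒x*y*z≡x (cong α hh⁻¹≡e)) ⟩
        α g * α h * α h⁻¹    ≡⟨ cong (_* α h⁻¹) gh≡aᵢ ⟩
        α (a i) * α h⁻¹      ∎)

    decompose-unique : ∀ g {h h′ i j} → H h → H h′ →
                       α (g · h) ≡ α (a i) → α (g · h′) ≡ α (a j) → i ≡ j × h ≡ h′
    decompose-unique g {i = i} {j} h∈H h′∈H gh≡aᵢ gh′≡aⱼ =
      i≡j , H-α-injective h∈H h′∈H
              (*-cancelˡ _ _ (α-nonzero g) (trans gh≡aᵢ (trans (cong (λ k → α (a k)) i≡j) (sym gh′≡aⱼ))))
      where
        i≡j : i ≡ j
        i≡j = cosets-disjoint i j (homothety p g)
                (homothety∈coset g h∈H gh≡aᵢ) (homothety∈coset g h′∈H gh′≡aⱼ)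

    translation-exists : ∀ g {h} → H h → α (g · h) ≡ α (a i₀) → Σ G λ h₂ → H h₂ × α (g · h₂) ≡ 1#
    translation-exists g {h} h∈H gh≡a₀ with a₀⁻¹ , a₀⁻¹∈H , a₀a₀⁻¹≡e ← H-inverse a₀∈H =
      h · a₀⁻¹ , H-· h∈H a₀⁻¹∈H , (begin
        α g * (α h * α a₀⁻¹)   ≡⟨ sym (*-assoc (α g) (α h) (α a₀⁻¹)) ⟩
        α g * α h * α a₀⁻¹     ≡⟨ cong (_* α a₀⁻¹) gh≡a₀ ⟩
        α (a i₀) * α a₀⁻¹      ≡⟨ cong α a₀a₀⁻¹≡e ⟩
        1#                     ∎)

    translation⇒i≡i₀ : ∀ g {h h′ i} → H h → H h′ → α (g · h) ≡ 1# → α (g · h′) ≡ α (a i) → i ≡ i₀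
    translation⇒i≡i₀ g {h} {h′} {i} h∈H h′∈H gh≡1 gh′≡aᵢ with h⁻¹ , h⁻¹∈H , hh⁻¹≡e ← H-inverse h∈H =
      H-α⇒i≡i₀ (H-· h⁻¹∈H h′∈H) (begin
        α h⁻¹ * α h′   ≡⟨ cong (_* α h′) (sym (x*y≡1⇒y*z≡1⇒x≡z gh≡1 (cong α hh⁻¹≡e))) ⟩
        α g * α h′     ≡⟨ gh′≡aᵢ ⟩
        α (a i)        ∎)

    ∉H⇒≢ : ∀ {g h} → ¬ H g → H h → g ≢ h
    ∉H⇒≢ g∉H h∈H g≡h = g∉H (subst H (sym g≡h) h∈H)

    ∉H⇒·H≢e : ∀ {g h} → ¬ H g → H h → g · h ≢ e
    ∉H⇒·H≢e {g} {h} g∉H h∈H gh≡e with h⁻¹ , h⁻¹∈H , hh⁻¹≡e ← H-inverse h∈H =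
      ∉H⇒≢ g∉H h⁻¹∈H (Stab-α-injective
        (Stab-cancelʳ {g = g} {h = h} (H⊆Stab h∈H) (subst (Stab p) (sym gh≡e) Stab-e))
        (H⊆Stab h⁻¹∈H)
        (x*y≡1⇒y*z≡1⇒x≡z (cong α gh≡e) (cong α hh⁻¹≡e)))

    X : G → Set
    X g = (∃ λ i → (i ≢ i₀) × (a i ^G) g) ⊎ (K g × ¬ (g ≡ e))

    Y : G → Set
    Y g = ∃ λ i → (a i ^G) g

    X-independent : ∀ g h → H g → H h → ¬ CSAdj _·_ X g h
    X-independent g h g∈H h∈H (_ , inj₁ (i , i≢i₀ , gh∈aᵢᴳ)) =
      i≢i₀ (H-α⇒i≡i₀ (H-· g∈H h∈H) (^G⇒α≡ (a i) gh∈aᵢᴳ))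
    X-independent g h g∈H h∈H (_ , inj₂ (gh∈K , gh≢e)) =
      gh≢e (Stab-α-injective (H⊆Stab (H-· g∈H h∈H)) Stab-e gh∈K)

    UniqueNeighbour : (G → Set) → G → Set
    UniqueNeighbour Z g = Σ G λ h → H h × CSAdj _·_ Z g h × (∀ h′ → H h′ → CSAdj _·_ Z g h′ → h′ ≡ h)

    class-neighbour : ∀ g {h i} → ¬ H g → H h → α (g · h) ≡ α (a i) → i ≢ i₀ → UniqueNeighbour X g
    class-neighbour g {h} {i} g∉H h∈H gh≡aᵢ i≢i₀ =
      h , h∈H , (∉H⇒≢ g∉H h∈H , inj₁ (i , i≢i₀ , α≡⇒^G (a i) (α-a≢1 i) gh≡aᵢ)) , unique
      where
        unique : ∀ h′ → H h′ → CSAdj _·_ X g h′ → h′ ≡ h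
        unique h′ h′∈H (_ , inj₁ (j , _ , gh′∈aⱼᴳ)) =
          sym (proj₂ (decompose-unique g h∈H h′∈H gh≡aᵢ (^G⇒α≡ (a j) gh′∈aⱼᴳ)))
        unique h′ h′∈H (_ , inj₂ (gh′∈K , _)) =
          ⊥-elim (i≢i₀ (translation⇒i≡i₀ g h′∈H h∈H gh′∈K gh≡aᵢ))

    translation-neighbour : ∀ g {h i} → ¬ H g → H h → α (g · h) ≡ α (a i) → i ≡ i₀ → UniqueNeighbour X g
    translation-neighbour g g∉H h∈H gh≡a₀ refl = neighbour (translation-exists g h∈H gh≡a₀)
      where
        neighbour : (Σ G λ h₂ → H h₂ × α (g · h₂) ≡ 1#) → UniqueNeighbour X g
        neighbour (h₂ , h₂∈H , gh₂≡1) =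
          h₂ , h₂∈H , (∉H⇒≢ g∉H h₂∈H , inj₂ (gh₂≡1 , ∉H⇒·H≢e g∉H h₂∈H)) , unique
          where
            unique : ∀ h′ → H h′ → CSAdj _·_ X g h′ → h′ ≡ h₂
            unique h′ h′∈H (_ , inj₁ (j , j≢i₀ , gh′∈aⱼᴳ)) =
              ⊥-elim (j≢i₀ (sym (proj₁ (decompose-unique g h∈H h′∈H gh≡a₀ (^G⇒α≡ (a j) gh′∈aⱼᴳ)))))
            unique h′ h′∈H (_ , inj₂ (gh′≡1 , _)) =
              H-α-injective h′∈H h₂∈H (*-cancelˡ _ _ (α-nonzero g) (trans gh′≡1 (sym gh₂≡1)))

    X-unique-neighbour : ∀ g → ¬ H g → UniqueNeighbour X g
    X-unique-neighbour g g∉H =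
      let i , h , h∈H , gh≡aᵢ = decompose g in
      [ translation-neighbour g g∉H h∈H gh≡aᵢ , class-neighbour g g∉H h∈H gh≡aᵢ ]′ (toSum (i Fin.≟ i₀))

    Y-neighbour : ∀ g {h i} → IsNonsquareOf (a i₀) H → H h → α (g · h) ≡ α (a i) → UniqueNeighbour Y g
    Y-neighbour g {h} {i} a₀-nonsquare h∈H gh≡aᵢ = h , h∈H , (g≢h , i , α≡⇒^G (a i) (α-a≢1 i) gh≡aᵢ) , unique
      where
        g≢h : g ≢ h
        g≢h g≡h = a₀-nonsquare h h∈H
          (Stab-α-injective (a∈Stab i₀) (Stab-· {g = h} {h = h} (H⊆Stab h∈H) (H⊆Stab h∈H))
            (subst (λ j → α (a j) ≡ α (h · h)) (H-α⇒i≡i₀ (H-· h∈H h∈H) hh≡aᵢ) (sym hh≡aᵢ)))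
          where
            hh≡aᵢ : α (h · h) ≡ α (a i)
            hh≡aᵢ = subst (λ x → α (x · h) ≡ α (a i)) g≡h gh≡aᵢ
        unique : ∀ h′ → H h′ → CSAdj _·_ Y g h′ → h′ ≡ h
        unique h′ h′∈H (_ , j , gh′∈aⱼᴳ) =
          sym (proj₂ (decompose-unique g h∈H h′∈H gh≡aᵢ (^G⇒α≡ (a j) gh′∈aⱼᴳ)))

    perfectCode : IsPerfectCode (CSAdj _·_ X) H
    perfectCode = X-independent , X-unique-neighbour

    totalPerfectCode : IsNonsquareOf (a i₀) H → IsTotalPerfectCode (CSAdj _·_ Y) H
    totalPerfectCode a₀-nonsquare g =
      let i , h , h∈H , gh≡aᵢ = decompose g in Y-neighbour g a₀-nonsquare h∈H gh≡aᵢ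

open import Data.Nat using (_*_)

theorem5p13 : (q : ℕ) (F : Field) → FiniteFieldOfOrder q F →
    let open AGL F in
    (c : G) → IsFrobeniusComplement ⟨ c ⟩ →
    (s t : ℕ) (0<s : 0 < s) → 1 < t → q ∸ 1 ≡ s * t →
    (a : Fin s → G) → IsLeftTransversal a ⟨ c ^ s ⟩ ⟨ c ⟩ →
    ⟨ c ^ s ⟩ (a (fromℕ< 0<s)) → a (fromℕ< 0<s) ≢ e →
    let i₀ = fromℕ< 0<s
        X : G → Set
        X g = (∃ λ i → (i ≢ i₀) × (a i ^G) g) ⊎ (K g × ¬ (g ≡ e))
        Y : G → Set
        Y g = ∃ λ i → (a i ^G) g
    in IsPerfectCode (CSAdj _·_ X) ⟨ c ^ s ⟩
       × (IsNonsquareOf (a i₀) ⟨ c ^ s ⟩ → IsTotalPerfectCode (CSAdj _·_ Y) ⟨ c ^ s ⟩)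
theorem5p13 q F finite c (p , ⟨c⟩⇔Stab) s t 0<s _ _ a transversal a₀∈H a₀≢e =
  perfectCode , totalPerfectCode
  where open TransversalCodes.Transversal F finite c p ⟨c⟩⇔Stab s a (fromℕ< 0<s) transversal a₀∈H a₀≢e
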